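{- For all integers $n > 2$, $f(n) \le 2\binom{n}{2}$.
   Context: A family $\mathcal{F}$ of subsets of a set is $2$-laminar if whenever $A,B \in \mathcal{F}$ satisfy $|A \cap B| \ge 2$, we have $A \subseteq B$ or $B \subseteq A$. For a positive integer $n$, $f(n)$ denotes the maximum of $|\{A \in \mathcal{F} : |A| \ge 2\}|$ over all $2$-laminar families $\mathcal{F}$ of subsets of $[n]=\{1,\dots,n\}$. -}

module Defs where

open import Data.Nat using (ℕ; _≤_; _≤?_)
open import Data.Fin.Subset using (Subset; _∩_; _⊆_; ∣_∣)
open import Data.List using (List; length; filter)
open import Data.List.Membership.Propositional using (_∈_)
open import Data.Sum using (_⊎_)

-- A family of subsets of [n] = Fin n, represented as a list of subsets
-- (duplicate-freeness is imposed separately, so the list is a set).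

TwoLaminar : {n : ℕ} → List (Subset n) → Set
TwoLaminar {n} F =
  ∀ {A B : Subset n} → A ∈ F → B ∈ F → 2 ≤ ∣ A ∩ B ∣ → (A ⊆ B) ⊎ (B ⊆ A)

bigCount : {n : ℕ} → List (Subset n) → ℕ
bigCount F = length (filter (λ A → 2 ≤? ∣ A ∣) F)

-- Split a 2-laminar family on [n+1] according to whether a member contains the
-- point 0. Removing 0 from the members that avoid it leaves a 2-laminar family
-- on [n]; removing 0 from the members that contain it leaves a laminar family
-- (any two of its sets that meet are nested), and a laminar family of distinct
-- nonempty subsets of [n] has at most 2n members. Hence f(n+1) ≤ f(n) + 2n,
-- which sums to f(n) ≤ 2·C(n,2).
module Submission where

open import Defs
open import Data.Bool as Bool using (Bool; true; false)
open import Data.Fin.Subset using (Subset; _∩_; _⊆_; ∣_∣; ⊥)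
open import Data.Fin.Subset.Properties
  using (drop-∷-⊆; ∣p∣≤∣x∷p∣; p⊆q⇒∣p∣≤∣q∣; x∈p∩q⁺; ⊆-antisym)
open import Data.List using (List; []; _∷_; length; filter; _++_)
open import Data.List.Properties using (length-++)
open import Data.List.Membership.Propositional using (_∈_)
open import Data.List.Membership.Propositional.Properties using (∈-filter⁻; ∈-++⁻)
import Data.List.Membership.DecPropositional as DecMembership
open import Data.List.Relation.Unary.All as All using (All; []; _∷_)
open import Data.List.Relation.Unary.All.Properties using (¬Any⇒All¬; All¬⇒¬Any; all-filter)
open import Data.List.Relation.Unary.Any using (here; there)
open import Data.List.Relation.Unary.AllPairs using ([]; _∷_)
open import Data.List.Relation.Unary.Unique.Propositional using (Unique)
import Data.List.Relation.Unary.Unique.Propositional.Properties as Unique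
open import Data.Nat using (ℕ; suc; _<_; _≤_; _*_; _+_; z≤n; s≤s; _<ᵇ_; _<?_; _≟_)
open import Data.Nat.Combinatorics using (_C_; nCk+nC[k+1]≡[n+1]C[k+1]; nC1≡n)
open import Data.Nat.Properties
  using (≤-refl; ≤-trans; ≤-reflexive; +-suc; +-comm; *-suc; *-distribˡ-+;
         +-monoˡ-≤; +-monoʳ-≤; +-mono-≤; n≢0⇒n>0; module ≤-Reasoning)
open import Data.Product using (∃; _,_; proj₁; proj₂)
open import Data.Sum as Sum using (_⊎_; inj₁; inj₂)
open import Data.Vec as Vec using ([]; _∷_)
open import Data.Vec.Properties using (≡-dec)
open import Function using (_∘_)
open import Level using (Level)
open import Relation.Binary.PropositionalEquality
  using (_≡_; refl; sym; trans; cong; module ≡-Reasoning)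
open import Relation.Nullary using (Dec; yes; no; contradiction)
open import Relation.Unary using (Pred; Decidable)
open import Relation.Unary.Properties using (∁?)

private
  variable
    a ℓ : Level
    A : Set a
    k m n : ℕ
    t : Subset n

module _ {P : Pred A ℓ} (P? : Decidable P) where

  length-filter-+-filter-∁ : ∀ xs → length (filter P? xs) + length (filter (∁? P?) xs) ≡ length xs
  length-filter-+-filter-∁ [] = refl
  length-filter-+-filter-∁ (x ∷ xs) with P? x
  ... | yes _ = cong suc (length-filter-+-filter-∁ xs)
  ... | no _ = trans (+-suc _ _) (cong suc (length-filter-+-filter-∁ xs))

  length-filter≤1 : ∀ {xs} → Unique xs → (∀ {x y} → x ∈ xs → y ∈ xs → P x → P y → x ≡ y) →
                    length (filter P? xs) ≤ 1
  length-filter≤1 {xs} u P-unique = length≤1 (Unique.filter⁺ P? u) same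
    where
    same : ∀ {x y} → x ∈ filter P? xs → y ∈ filter P? xs → x ≡ y
    same x∈ y∈ with ∈-filter⁻ P? x∈ | ∈-filter⁻ P? y∈
    ... | x∈xs , Px | y∈xs , Py = P-unique x∈xs y∈xs Px Py

    length≤1 : ∀ {ys} → Unique ys → (∀ {x y} → x ∈ ys → y ∈ ys → x ≡ y) → length ys ≤ 1
    length≤1 {[]} _ _ = z≤n
    length≤1 {_ ∷ []} _ _ = ≤-refl
    length≤1 {_ ∷ _ ∷ _} ((x≢y ∷ _) ∷ _) eq = contradiction (eq (here refl) (there (here refl))) x≢y

  length≤1+length-filter-∁ : ∀ {xs} → Unique xs → (∀ {x y} → x ∈ xs → y ∈ xs → P x → P y → x ≡ y) →
                             length xs ≤ suc (length (filter (∁? P?) xs))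
  length≤1+length-filter-∁ {xs} u P-unique = begin
    length xs                                            ≡⟨ sym (length-filter-+-filter-∁ xs) ⟩
    length (filter P? xs) + length (filter (∁? P?) xs)   ≤⟨ +-monoˡ-≤ _ (length-filter≤1 u P-unique) ⟩
    suc (length (filter (∁? P?) xs))                     ∎
    where open ≤-Reasoning

Laminar : ℕ → List (Subset n) → Set
Laminar {n} k F = ∀ {A B : Subset n} → A ∈ F → B ∈ F → k ≤ ∣ A ∩ B ∣ → (A ⊆ B) ⊎ (B ⊆ A)

∣p∣≡0⇒p≡⊥ : (p : Subset n) → ∣ p ∣ ≡ 0 → p ≡ ⊥
∣p∣≡0⇒p≡⊥ [] _ = refl
∣p∣≡0⇒p≡⊥ (false ∷ p) ∣p∣≡0 = cong (false ∷_) (∣p∣≡0⇒p≡⊥ p ∣p∣≡0)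

p⊆q⇒∣p∣≤∣p∩q∣ : {p q : Subset n} → p ⊆ q → ∣ p ∣ ≤ ∣ p ∩ q ∣
p⊆q⇒∣p∣≤∣p∩q∣ p⊆q = p⊆q⇒∣p∣≤∣q∣ (λ x∈p → x∈p∩q⁺ (x∈p , p⊆q x∈p))

slice : Bool → List (Subset (suc n)) → List (Subset n)
slice b [] = []
slice b ((x ∷ a) ∷ F) with x Bool.≟ b
... | yes _ = a ∷ slice b F
... | no _ = slice b F

∈-slice⁻ : ∀ b F → t ∈ slice b F → (b ∷ t) ∈ F
∈-slice⁻ b ((x ∷ a) ∷ F) t∈ with x Bool.≟ b
∈-slice⁻ b ((x ∷ a) ∷ F) (here refl) | yes refl = here refl
∈-slice⁻ b ((x ∷ a) ∷ F) (there t∈) | yes refl = there (∈-slice⁻ b F t∈)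
∈-slice⁻ b ((x ∷ a) ∷ F) t∈ | no _ = there (∈-slice⁻ b F t∈)

slice-unique : ∀ b {F : List (Subset (suc n))} → Unique F → Unique (slice b F)
slice-unique b {[]} [] = []
slice-unique b {(x ∷ a) ∷ F} (x∷a∉F ∷ u) with x Bool.≟ b
... | yes refl = ¬Any⇒All¬ _ (All¬⇒¬Any x∷a∉F ∘ ∈-slice⁻ b F) ∷ slice-unique b u
... | no _ = slice-unique b u

length-slices : (F : List (Subset (suc n))) → length F ≡ length (slice false F) + length (slice true F)
length-slices [] = refl
length-slices ((false ∷ a) ∷ F) = cong suc (length-slices F)
length-slices ((true ∷ a) ∷ F) = trans (cong suc (length-slices F)) (sym (+-suc _ _))

laminar-tails : {T : List (Subset (suc n))} {U : List (Subset n)} →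
                (∀ {u} → u ∈ U → ∃ λ h → (h ∷ u) ∈ T) → Laminar k T → Laminar k U
laminar-tails extend lam {A} {B} A∈U B∈U k≤∣A∩B∣ with extend A∈U | extend B∈U
... | h , hA∈T | h′ , h′B∈T =
  Sum.map drop-∷-⊆ drop-∷-⊆ (lam hA∈T h′B∈T (≤-trans k≤∣A∩B∣ (∣p∣≤∣x∷p∣ (h Bool.∧ h′) (A ∩ B))))

laminar-slice : ∀ b {F : List (Subset (suc n))} → Laminar k F → Laminar k (slice b F)
laminar-slice b {F} = laminar-tails (λ u∈ → b , ∈-slice⁻ b F u∈)

-- Two members containing 0 meet in one point more than their tails do.
laminar-slice-true : {F : List (Subset (suc n))} → Laminar (suc k) F → Laminar k (slice true F)
laminar-slice-true {F = F} lam A∈ B∈ k≤ =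
  Sum.map drop-∷-⊆ drop-∷-⊆ (lam (∈-slice⁻ true F A∈) (∈-slice⁻ true F B∈) (s≤s k≤))

module Twins {T : List (Subset (suc m))} (lam : Laminar 1 T) (ne : All (λ A → 0 < ∣ A ∣) T) where

  twin-⊆⇒≡ : {t t′ : Subset m} → (false ∷ t) ∈ T → (true ∷ t) ∈ T → (false ∷ t′) ∈ T → t ⊆ t′ → t ≡ t′
  twin-⊆⇒≡ 0t∈ 1t∈ 0t′∈ t⊆t′ with lam 1t∈ 0t′∈ (≤-trans (All.lookup ne 0t∈) (p⊆q⇒∣p∣≤∣p∩q∣ t⊆t′))
  ... | inj₁ 1t⊆0t′ = contradiction (1t⊆0t′ Vec.here) λ ()
  ... | inj₂ 0t′⊆1t = ⊆-antisym t⊆t′ (drop-∷-⊆ 0t′⊆1t)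

  twin-unique : {t t′ : Subset m} → (false ∷ t) ∈ T → (true ∷ t) ∈ T →
                (false ∷ t′) ∈ T → (true ∷ t′) ∈ T → t ≡ t′
  twin-unique 0t∈ 1t∈ 0t′∈ 1t′∈ with lam 1t∈ 1t′∈ (s≤s z≤n)
  ... | inj₁ 1t⊆1t′ = twin-⊆⇒≡ 0t∈ 1t∈ 0t′∈ (drop-∷-⊆ 1t⊆1t′)
  ... | inj₂ 1t′⊆1t = sym (twin-⊆⇒≡ 0t′∈ 1t′∈ 0t∈ (drop-∷-⊆ 1t′⊆1t))

-- Deleting 0 from every member of T loses at most two sets: the singleton {0},
-- and one tail t for which both t and {0} ∪ t belong to T.
module Peel {T : List (Subset (suc m))} (u : Unique T) (lam : Laminar 1 T) (ne : All (λ A → 0 < ∣ A ∣) T) where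
  open DecMembership (≡-dec {n = m} Bool._≟_) using (_∈?_)
  open Twins lam ne

  T₀ T₁ T₁⁺ T₁′ U : List (Subset m)

  empty? : Decidable (λ (t : Subset m) → ∣ t ∣ ≡ 0)
  empty? t = ∣ t ∣ ≟ 0

  ∈T₀? : Decidable (_∈ T₀)
  ∈T₀? = _∈? T₀

  T₀ = slice false T
  T₁ = slice true T
  T₁⁺ = filter (∁? empty?) T₁
  T₁′ = filter (∁? ∈T₀?) T₁⁺
  U = T₀ ++ T₁′

  ∈T₁⁺⁻ : t ∈ T₁⁺ → t ∈ T₁
  ∈T₁⁺⁻ = proj₁ ∘ ∈-filter⁻ (∁? empty?) {xs = T₁}
  ∈T₁′⁻ : t ∈ T₁′ → t ∈ T₁⁺
  ∈T₁′⁻ = proj₁ ∘ ∈-filter⁻ (∁? ∈T₀?) {xs = T₁⁺}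

  U-extends : t ∈ U → ∃ λ h → (h ∷ t) ∈ T
  U-extends t∈U with ∈-++⁻ T₀ t∈U
  ... | inj₁ t∈T₀ = false , ∈-slice⁻ false T t∈T₀
  ... | inj₂ t∈T₁′ = true , ∈-slice⁻ true T (∈T₁⁺⁻ (∈T₁′⁻ t∈T₁′))

  U-unique : Unique U
  U-unique = Unique.++⁺ (slice-unique false u)
    (Unique.filter⁺ (∁? ∈T₀?) (Unique.filter⁺ (∁? empty?) (slice-unique true u)))
    (λ (t∈T₀ , t∈T₁′) → proj₂ (∈-filter⁻ (∁? ∈T₀?) {xs = T₁⁺} t∈T₁′) t∈T₀)

  U-laminar : Laminar 1 U
  U-laminar = laminar-tails U-extends lam

  U-nonempty : All (λ A → 0 < ∣ A ∣) U
  U-nonempty = All.tabulate nonempty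
    where
    nonempty : t ∈ U → 0 < ∣ t ∣
    nonempty t∈U with ∈-++⁻ T₀ t∈U
    ... | inj₁ t∈T₀ = All.lookup ne (∈-slice⁻ false T t∈T₀)
    ... | inj₂ t∈T₁′ = n≢0⇒n>0 (proj₂ (∈-filter⁻ (∁? empty?) {xs = T₁} (∈T₁′⁻ t∈T₁′)))

  length≤2+length-U : length T ≤ 2 + length U
  length≤2+length-U = begin
    length T                                  ≡⟨ length-slices T ⟩
    length T₀ + length T₁                     ≤⟨ +-monoʳ-≤ (length T₀) (≤-trans drop-empty (s≤s drop-twin)) ⟩
    length T₀ + suc (suc (length T₁′))        ≡⟨ trans (+-suc _ _) (cong suc (+-suc _ _)) ⟩
    2 + (length T₀ + length T₁′)              ≡⟨ cong (2 +_) (sym (length-++ T₀)) ⟩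
    2 + length U                              ∎
    where
    open ≤-Reasoning
    drop-empty : length T₁ ≤ suc (length T₁⁺)
    drop-empty = length≤1+length-filter-∁ empty? (slice-unique true u)
      (λ {t} {t′} _ _ ∣t∣≡0 ∣t′∣≡0 → trans (∣p∣≡0⇒p≡⊥ t ∣t∣≡0) (sym (∣p∣≡0⇒p≡⊥ t′ ∣t′∣≡0)))
    drop-twin : length T₁⁺ ≤ suc (length T₁′)
    drop-twin = length≤1+length-filter-∁ ∈T₀? (Unique.filter⁺ (∁? empty?) (slice-unique true u))
      (λ t∈ t′∈ t∈T₀ t′∈T₀ → twin-unique
        (∈-slice⁻ false T t∈T₀) (∈-slice⁻ true T (∈T₁⁺⁻ t∈))
        (∈-slice⁻ false T t′∈T₀) (∈-slice⁻ true T (∈T₁⁺⁻ t′∈)))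

laminar-length≤ : ∀ m (T : List (Subset m)) → Unique T → Laminar 1 T → All (λ A → 0 < ∣ A ∣) T →
                  length T ≤ 2 * m
laminar-length≤ 0 [] _ _ _ = z≤n
laminar-length≤ 0 ([] ∷ _) _ _ (() ∷ _)
laminar-length≤ (suc m) T u lam ne = begin
  length T       ≤⟨ length≤2+length-U ⟩
  2 + length U   ≤⟨ +-monoʳ-≤ 2 (laminar-length≤ m U U-unique U-laminar U-nonempty) ⟩
  2 + 2 * m      ≡⟨ sym (*-suc 2 m) ⟩
  2 * suc m      ∎
  where
  open Peel u lam ne
  open ≤-Reasoning

nonempty? : (A : Subset n) → Dec (0 < ∣ A ∣)
nonempty? A = 0 <? ∣ A ∣

-- Both size tests compute through _<ᵇ_; for a member true ∷ a they reduce to the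
-- same boolean 0 <ᵇ ∣ a ∣.
bigCount-slices : (F : List (Subset (suc n))) →
                  bigCount F ≡ bigCount (slice false F) + length (filter nonempty? (slice true F))
bigCount-slices [] = refl
bigCount-slices ((false ∷ a) ∷ F) with 1 <ᵇ ∣ a ∣
... | true = cong suc (bigCount-slices F)
... | false = bigCount-slices F
bigCount-slices ((true ∷ a) ∷ F) with 0 <ᵇ ∣ a ∣
... | true = trans (cong suc (bigCount-slices F)) (sym (+-suc _ _))
... | false = bigCount-slices F

bigCount-Subset0 : (F : List (Subset 0)) → bigCount F ≡ 0
bigCount-Subset0 [] = refl
bigCount-Subset0 ([] ∷ F) = bigCount-Subset0 F

2*nC2+2*n≡2*[1+n]C2 : ∀ n → 2 * (n C 2) + 2 * n ≡ 2 * (suc n C 2)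
2*nC2+2*n≡2*[1+n]C2 n = begin
  2 * (n C 2) + 2 * n          ≡⟨ +-comm (2 * (n C 2)) (2 * n) ⟩
  2 * n + 2 * (n C 2)          ≡⟨ cong (λ c → 2 * c + 2 * (n C 2)) (sym (nC1≡n n)) ⟩
  2 * (n C 1) + 2 * (n C 2)    ≡⟨ sym (*-distribˡ-+ 2 (n C 1) (n C 2)) ⟩
  2 * (n C 1 + n C 2)          ≡⟨ cong (2 *_) (nCk+nC[k+1]≡[n+1]C[k+1] n 1) ⟩
  2 * (suc n C 2)              ∎
  where open ≡-Reasoning

twoLaminar-bigCount≤ : ∀ n (F : List (Subset n)) → Unique F → TwoLaminar F → bigCount F ≤ 2 * (n C 2)
twoLaminar-bigCount≤ 0 F _ _ = ≤-reflexive (bigCount-Subset0 F)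
twoLaminar-bigCount≤ (suc n) F u lam = begin
  bigCount F                                                  ≡⟨ bigCount-slices F ⟩
  bigCount (slice false F) + length W                         ≤⟨ +-mono-≤ count₀ count₁ ⟩
  2 * (n C 2) + 2 * n                                         ≡⟨ 2*nC2+2*n≡2*[1+n]C2 n ⟩
  2 * (suc n C 2)                                             ∎
  where
  open ≤-Reasoning
  W : List (Subset n)
  W = filter nonempty? (slice true F)
  count₀ : bigCount (slice false F) ≤ 2 * (n C 2)
  count₀ = twoLaminar-bigCount≤ n (slice false F) (slice-unique false u) (laminar-slice false lam)
  count₁ : length W ≤ 2 * n
  count₁ = laminar-length≤ n W (Unique.filter⁺ nonempty? (slice-unique true u))
    (λ A∈ B∈ → laminar-slice-true lam (proj₁ (∈-filter⁻ nonempty? A∈)) (proj₁ (∈-filter⁻ nonempty? B∈)))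
    (all-filter nonempty? (slice true F))

corollary3p4 : (n : ℕ) → 2 < n → (F : List (Subset n)) → Unique F →
    TwoLaminar F → bigCount F ≤ 2 * (n C 2)
corollary3p4 n _ = twoLaminar-bigCount≤ n
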